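{- Let $\mathcal{A}=A_1\times\cdots\times A_m$ with finite nonempty $A_i$ and $A_i=A_{m-i+1}$. Let $H,G\subseteq\bar{\mathcal{A}}$ be prefix-free with $|H|\cdot|G|\le|\mathcal{A}|/4$, and suppose $\cup H=\cup G_{\mathrm{rev}}$. Then $$|\cup H|\ge\frac{|\mathcal{A}|}{2}\Big(1+\sqrt{1-4|H||G|/|\mathcal{A}|}\Big)\quad\text{or}\quad|\cup H|\le\frac{|\mathcal{A}|}{2}\Big(1-\sqrt{1-4|H||G|/|\mathcal{A}|}\Big).$$ In particular, $\min(|\cup H|,|\mathcal{A}|-|\cup H|)\le|H|\cdot|G|+O(|H|^2|G|^2/|\mathcal{A}|)$.
   Context: $\bar{\mathcal{A}}=\bigcup_{i=0}^mA_1\times\cdots\times A_i$. For $\vec a\in\bar{\mathcal{A}}$ of length $\ell$, the associated set is $\vec a\times A_{\ell+1}\times\cdots\times A_m\subseteq\mathcal{A}$, and the reverse set is $\overleftarrow{a}=A_1\times\cdots\times A_{m-\ell}\times\{a_\ell\}\times\cdots\times\{a_1\}$. $\cup H$ is the union of the associated sets of elements of $H$, and $\cup G_{\mathrm{rev}}$ the union of the reverse sets of elements of $G$. Prefix-free: no element is a proper prefix of another. -}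

module Defs where

open import Data.Nat using (ℕ; _<_; _≟_)
open import Data.List using (List; []; _∷_; map; concatMap; upTo; length; filter; reverse)
open import Data.List.Relation.Binary.Pointwise using (Pointwise)
open import Data.List.Relation.Binary.Prefix.Heterogeneous using (Prefix)
open import Data.List.Relation.Binary.Prefix.Heterogeneous.Properties using (prefix?)
open import Data.List.Relation.Unary.Any using (Any; any?)
open import Data.List.Membership.Propositional using (_∈_)
open import Relation.Binary.PropositionalEquality using (_≡_)

-- Convention: the factor A_i is {0, …, n_i - 1}, where ns = n_1 ∷ … ∷ n_m.
-- 𝒜 = A_1 × ⋯ × A_m : lists x with Pointwise _<_ x ns.
InA : List ℕ → List ℕ → Set
InA ns x = Pointwise _<_ x ns

-- Ā = ⋃_{i=0}^m A_1 × ⋯ × A_i : lists a that are a (possibly empty,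
-- possibly full) prefix-shaped tuple, i.e. a_j < n_j for j ≤ length a ≤ m.
InĀ : List ℕ → List ℕ → Set
InĀ ns a = Prefix _<_ a ns

_⊑_ : List ℕ → List ℕ → Set
a ⊑ b = Prefix _≡_ a b

PrefixFree : List (List ℕ) → Set
PrefixFree H = ∀ {a b} → a ∈ H → b ∈ H → a ⊑ b → a ≡ b

-- x ∈ ∪H  : x lies in the associated set a × A_{ℓ+1} × ⋯ × A_m of some a ∈ H
In∪ : List (List ℕ) → List ℕ → Set
In∪ H x = Any (λ a → a ⊑ x) H

-- x ∈ ∪G_rev : x lies in the reverse set A_1 × ⋯ × A_{m-ℓ} × {a_ℓ} × ⋯ × {a_1}
-- of some a ∈ G, i.e. a is a prefix of the reversal of x.
In∪rev : List (List ℕ) → List ℕ → Set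
In∪rev G x = Any (λ a → a ⊑ reverse x) G

tuples : List ℕ → List (List ℕ)
tuples []       = [] ∷ []
tuples (n ∷ ns) = concatMap (λ i → map (i ∷_) (tuples ns)) (upTo n)

card𝒜 : List ℕ → ℕ
card𝒜 ns = length (tuples ns)

card∪ : List ℕ → List (List ℕ) → ℕ
card∪ ns H = length (filter (λ x → any? (λ a → prefix? _≟_ a x) H) (tuples ns))

-- Write u = |∪H|, s = |𝒜 ∖ ∪H| and N = u + s = |𝒜|. A pair (x , y) with x ∈ ∪H and y ∉ ∪H is
-- encoded by a triple (h , g , c): h ∈ H is a prefix of x, say of length a; the word
-- w = x[..a] ++ y[a..] lies in ∪H = ∪G_rev, and g ∈ G witnesses this; c = y[..a] ++ x[a..].
-- The pair is recovered as x = h ++ c[a..] and y = c[..a] ++ reverse (g[..m−a]), because g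
-- must extend the reversed tail of y (otherwise y ∈ ∪G_rev = ∪H). Hence u s ≤ |H| |G| N, and
-- (2u − N)² = N² − 4us ≥ N² − 4|H||G|N.
module Submission where

open import Defs
open import Data.Nat using (ℕ; zero; suc; _≤_; _*_; _+_; _∸_; z≤n; s≤s; _≟_)
import Data.Nat.Properties as ℕ
open import Data.Integer using (ℤ; +_; _-_; +≤+) renaming (_*_ to _*ℤ_; _+_ to _+ℤ_; _≤_ to _≤ℤ_)
import Data.Integer.Properties as ℤ
open import Data.Integer.Tactic.RingSolver using (solve-∀)
open import Data.List using (List; []; _∷_; _++_; length; reverse; take; drop; map; concatMap; upTo; filter; cartesianProduct)
open import Data.List.Properties
  using (length-++; length-map; length-take; length-drop; length-reverse; take++drop≡id; reverse-++; reverse-involutive)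
open import Data.List.Relation.Unary.All using (All; [])
import Data.List.Relation.Unary.All as All
open import Data.List.Relation.Unary.Any using (Any; here; there; any?)
import Data.List.Relation.Unary.Any as Any
open import Data.List.Relation.Unary.Any.Properties using (lookup-result)
open import Data.List.Relation.Unary.Unique.Propositional using (Unique)
open import Data.List.Relation.Unary.AllPairs using ([]; _∷_)
import Data.List.Relation.Unary.Unique.Propositional.Properties as Unique
open import Data.List.Membership.Propositional using (_∈_; lose; find)
open import Data.List.Membership.Propositional.Properties
  using (∈-++⁻; ∈-++⁺ˡ; ∈-++⁺ʳ; ∈-∃++; ∈-map⁺; ∈-map⁻; ∈-concatMap⁺; ∈-concatMap⁻; ∈-upTo⁺; ∈-upTo⁻;
         ∈-filter⁻; ∈-cartesianProduct⁺; ∈-cartesianProduct⁻; ∈-lookup)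
open import Data.List.Relation.Binary.Pointwise using (Pointwise; []; _∷_; Pointwise-length)
import Data.List.Relation.Binary.Pointwise as Pointwise
open import Data.List.Relation.Binary.Prefix.Heterogeneous using (Prefix; []; _∷_; _++ᵖ_)
open import Data.List.Relation.Binary.Prefix.Heterogeneous.Properties using (length-mono; fromPointwise; prefix?)
open import Data.Product using (_×_; _,_)
open import Data.Sum using (_⊎_; inj₁; inj₂)
open import Data.Empty using (⊥)
open import Function using (_∘_)
open import Function.Bundles using (_⇔_; Equivalence)
open import Relation.Nullary using (¬_; Dec; yes; no; ¬?; contradiction)
open import Relation.Binary.PropositionalEquality using (_≡_; refl; sym; trans; cong; cong₂; subst; subst₂; _≢_; module ≡-Reasoning)

module _ {A : Set} where

  ∈-removeMiddle : ∀ {y x : A} us vs → y ∈ us ++ x ∷ vs → y ≢ x → y ∈ us ++ vs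
  ∈-removeMiddle us vs y∈ y≢x with ∈-++⁻ us y∈
  ... | inj₁ y∈us         = ∈-++⁺ˡ y∈us
  ... | inj₂ (here y≡x)   = contradiction y≡x y≢x
  ... | inj₂ (there y∈vs) = ∈-++⁺ʳ us y∈vs

  length-removeMiddle : ∀ (us : List A) x vs → length (us ++ x ∷ vs) ≡ suc (length (us ++ vs))
  length-removeMiddle []       x vs = refl
  length-removeMiddle (u ∷ us) x vs = cong suc (length-removeMiddle us x vs)

module _ {A B : Set} where

  length-≤-of-retraction : ∀ {L : List A} (M : List B) → Unique L
    → (f : ∀ {a} → a ∈ L → B) → (∀ {a} (a∈L : a ∈ L) → f a∈L ∈ M)
    → (g : B → A) → (∀ {a} (a∈L : a ∈ L) → g (f a∈L) ≡ a)
    → length L ≤ length M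
  length-≤-of-retraction {[]}    M _              f f∈M g gf = z≤n
  length-≤-of-retraction {a ∷ L} M (a∉L ∷ uniqL) f f∈M g gf with ∈-∃++ (f∈M (here refl))
  ... | us , vs , refl =
    subst (suc (length L) ≤_) (sym (length-removeMiddle us _ vs))
      (s≤s (length-≤-of-retraction (us ++ vs) uniqL (f ∘ there) f∘there∈ g (gf ∘ there)))
    where
    f∘there∈ : ∀ {b} (b∈L : b ∈ L) → f (there b∈L) ∈ us ++ vs
    f∘there∈ b∈L = ∈-removeMiddle us vs (f∈M (there b∈L))
      (λ eq → All.lookup a∉L b∈L (trans (sym (gf (here refl))) (trans (cong g (sym eq)) (gf (there b∈L)))))

  length-cartesianProduct : ∀ (xs : List A) (ys : List B) →
    length (cartesianProduct xs ys) ≡ length xs * length ys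
  length-cartesianProduct []       ys = refl
  length-cartesianProduct (x ∷ xs) ys = trans (length-++ (map (x ,_) ys))
    (cong₂ _+_ (length-map (x ,_) ys) (length-cartesianProduct xs ys))

module _ {A : Set} {P : A → Set} (P? : ∀ x → Dec (P x)) where

  length-filter+length-filter¬ : ∀ xs →
    length (filter P? xs) + length (filter (¬? ∘ P?) xs) ≡ length xs
  length-filter+length-filter¬ []       = refl
  length-filter+length-filter¬ (x ∷ xs) with P? x
  ... | yes _ = cong suc (length-filter+length-filter¬ xs)
  ... | no  _ = trans (ℕ.+-suc _ _) (cong suc (length-filter+length-filter¬ xs))

module _ {A : Set} where

  take-++-length : ∀ (xs ys : List A) → take (length xs) (xs ++ ys) ≡ xs
  take-++-length []       ys = refl
  take-++-length (x ∷ xs) ys = cong (x ∷_) (take-++-length xs ys)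

  drop-++-length : ∀ (xs ys : List A) → drop (length xs) (xs ++ ys) ≡ ys
  drop-++-length []       ys = refl
  drop-++-length (x ∷ xs) ys = drop-++-length xs ys

  length-take-≤ : ∀ {n} (xs : List A) → n ≤ length xs → length (take n xs) ≡ n
  length-take-≤ {n} xs n≤ = trans (length-take n xs) (ℕ.m≤n⇒m⊓n≡m n≤)

  Prefix-≡⇒≡take : ∀ {xs ys : List A} → Prefix _≡_ xs ys → xs ≡ take (length xs) ys
  Prefix-≡⇒≡take []           = refl
  Prefix-≡⇒≡take (refl ∷ pre) = cong (_ ∷_) (Prefix-≡⇒≡take pre)

  Prefix-≡-++ : ∀ (xs ys : List A) → Prefix _≡_ xs (xs ++ ys)
  Prefix-≡-++ xs ys = fromPointwise (Pointwise.refl refl) ++ᵖ ys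

  Prefix-≡-++⁻ : ∀ {zs : List A} xs ys → Prefix _≡_ zs (xs ++ ys) →
    Prefix _≡_ zs xs ⊎ take (length xs) zs ≡ xs
  Prefix-≡-++⁻ []       ys pre          = inj₂ refl
  Prefix-≡-++⁻ (x ∷ xs) ys []           = inj₁ []
  Prefix-≡-++⁻ (x ∷ xs) ys (refl ∷ pre) with Prefix-≡-++⁻ xs ys pre
  ... | inj₁ pre′ = inj₁ (refl ∷ pre′)
  ... | inj₂ eq   = inj₂ (cong (x ∷_) eq)

  splice : ℕ → List A → List A → List A
  splice n xs ys = take n xs ++ drop n ys

  take-splice : ∀ {n} xs ys → n ≤ length xs → take n (splice n xs ys) ≡ take n xs
  take-splice {n} xs ys n≤ = subst (λ k → take k (splice n xs ys) ≡ take n xs)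
    (length-take-≤ xs n≤) (take-++-length (take n xs) (drop n ys))

  drop-splice : ∀ {n} xs ys → n ≤ length xs → drop n (splice n xs ys) ≡ drop n ys
  drop-splice {n} xs ys n≤ = subst (λ k → drop k (splice n xs ys) ≡ drop n ys)
    (length-take-≤ xs n≤) (drop-++-length (take n xs) (drop n ys))

module _ {A B : Set} {R : A → B → Set} where

  splice⁺ : ∀ n {xs ys zs} → Pointwise R xs zs → Pointwise R ys zs → Pointwise R (splice n xs ys) zs
  splice⁺ zero    _          ys~zs      = ys~zs
  splice⁺ (suc n) []         []         = []
  splice⁺ (suc n) (r ∷ xs~zs) (_ ∷ ys~zs) = r ∷ splice⁺ n xs~zs ys~zs

tuples-complete : ∀ {ns x} → InA ns x → x ∈ tuples ns
tuples-complete {[]}     []          = here refl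
tuples-complete {n ∷ ns} (i<n ∷ x∈𝒜) =
  ∈-concatMap⁺ (λ j → map (j ∷_) (tuples ns)) (lose (∈-upTo⁺ i<n) (∈-map⁺ (_ ∷_) (tuples-complete x∈𝒜)))

tuples-sound : ∀ {ns x} → x ∈ tuples ns → InA ns x
tuples-sound {[]}     (here refl) = []
tuples-sound {n ∷ ns} x∈ with find (∈-concatMap⁻ (λ i → map (i ∷_) (tuples ns)) {xs = upTo n} x∈)
... | i , i∈upTo , x∈block with ∈-map⁻ (i ∷_) x∈block
... | _ , x′∈ , refl = ∈-upTo⁻ i∈upTo ∷ tuples-sound x′∈

prepend-unique : ∀ {is : List ℕ} {T : List (List ℕ)} → Unique is → Unique T →
  Unique (concatMap (λ i → map (i ∷_) T) is)
prepend-unique {[]}     []               uniqT = []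
prepend-unique {i ∷ is} {T} (i∉is ∷ uniqIs) uniqT =
  Unique.++⁺ (Unique.map⁺ (λ { refl → refl }) uniqT) (prepend-unique uniqIs uniqT) disjoint
  where
  disjoint : ∀ {v} → v ∈ map (i ∷_) T × v ∈ concatMap (λ j → map (j ∷_) T) is → ⊥
  disjoint (v∈i∷T , v∈rest) with ∈-map⁻ (i ∷_) v∈i∷T | find (∈-concatMap⁻ (λ j → map (j ∷_) T) {xs = is} v∈rest)
  ... | _ , _ , refl | j , j∈is , v∈j∷T with ∈-map⁻ (j ∷_) v∈j∷T
  ... | _ , _ , refl = All.lookup i∉is j∈is refl

tuples-unique : ∀ ns → Unique (tuples ns)
tuples-unique []       = [] ∷ []
tuples-unique (n ∷ ns) = prepend-unique (Unique.upTo⁺ n) (tuples-unique ns)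

module PairCode (ns : List ℕ) (H G : List (List ℕ))
  (∪H⇔∪Grev : ∀ x → InA ns x → (In∪ H x ⇔ In∪rev G x)) where

  decode : List ℕ × List ℕ × List ℕ → List ℕ × List ℕ
  decode (h , g , c) =
    h ++ drop (length h) c , take (length h) c ++ reverse (take (length ns ∸ length h) g)

  module Encode {x y : List ℕ} (x∈𝒜 : InA ns x) (y∈𝒜 : InA ns y) (x∈∪H : In∪ H x) where

    h : List ℕ
    h = Any.lookup x∈∪H

    h∈H : h ∈ H
    h∈H = ∈-lookup {xs = H} (Any.index x∈∪H)

    a : ℕ
    a = length h

    h≡take : h ≡ take a x
    h≡take = Prefix-≡⇒≡take (lookup-result x∈∪H)

    a≤∣x∣ : a ≤ length x
    a≤∣x∣ = length-mono (lookup-result x∈∪H)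

    a≤∣y∣ : a ≤ length y
    a≤∣y∣ = subst (a ≤_) (trans (Pointwise-length x∈𝒜) (sym (Pointwise-length y∈𝒜))) a≤∣x∣

    w∈∪Grev : In∪rev G (splice a x y)
    w∈∪Grev = Equivalence.to (∪H⇔∪Grev (splice a x y) (splice⁺ a x∈𝒜 y∈𝒜))
      (lose h∈H (subst (λ z → z ⊑ splice a x y) (sym h≡take) (Prefix-≡-++ (take a x) (drop a y))))

    g : List ℕ
    g = Any.lookup w∈∪Grev

    g∈G : g ∈ G
    g∈G = ∈-lookup {xs = G} (Any.index w∈∪Grev)

    -- If g ended inside the reversed tail of y, then y itself would lie in ∪G_rev = ∪H.
    take-g≡reverse-tail : ¬ In∪ H y → take (length ns ∸ a) g ≡ reverse (drop a y)
    take-g≡reverse-tail y∉∪H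
      with Prefix-≡-++⁻ (reverse (drop a y)) (reverse (take a x))
             (subst (g ⊑_) (reverse-++ (take a x) (drop a y)) (lookup-result w∈∪Grev))
    ... | inj₂ eq = subst (λ k → take k g ≡ reverse (drop a y)) ∣tail∣ eq
      where
      ∣tail∣ : length (reverse (drop a y)) ≡ length ns ∸ a
      ∣tail∣ = trans (length-reverse (drop a y)) (trans (length-drop a y) (cong (_∸ a) (Pointwise-length y∈𝒜)))
    ... | inj₁ g⊑tail = contradiction (Equivalence.from (∪H⇔∪Grev y y∈𝒜) y∈∪Grev) y∉∪H
      where
      y∈∪Grev : In∪rev G y
      y∈∪Grev = lose g∈G
        (subst (g ⊑_) (trans (sym (reverse-++ (take a y) (drop a y))) (cong reverse (take++drop≡id a y)))
          (g⊑tail ++ᵖ reverse (take a y)))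

    code : List ℕ × List ℕ × List ℕ
    code = h , g , splice a y x

    code∈ : code ∈ cartesianProduct H (cartesianProduct G (tuples ns))
    code∈ = ∈-cartesianProduct⁺ h∈H (∈-cartesianProduct⁺ g∈G (tuples-complete (splice⁺ a y∈𝒜 x∈𝒜)))

    decode-code : ¬ In∪ H y → decode code ≡ (x , y)
    decode-code y∉∪H = cong₂ _,_ x≡ y≡
      where
      open ≡-Reasoning
      x≡ : h ++ drop a (splice a y x) ≡ x
      x≡ = begin
        h ++ drop a (splice a y x)  ≡⟨ cong₂ _++_ h≡take (drop-splice y x a≤∣y∣) ⟩
        take a x ++ drop a x        ≡⟨ take++drop≡id a x ⟩
        x                           ∎
      y≡ : take a (splice a y x) ++ reverse (take (length ns ∸ a) g) ≡ y
      y≡ = begin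
        take a (splice a y x) ++ reverse (take (length ns ∸ a) g)
          ≡⟨ cong₂ _++_ (take-splice y x a≤∣y∣) (cong reverse (take-g≡reverse-tail y∉∪H)) ⟩
        take a y ++ reverse (reverse (drop a y))
          ≡⟨ cong (take a y ++_) (reverse-involutive (drop a y)) ⟩
        take a y ++ drop a y
          ≡⟨ take++drop≡id a y ⟩
        y ∎

  inside? : ∀ x → Dec (In∪ H x)
  inside? x = any? (λ a → prefix? _≟_ a x) H

  inside outside : List (List ℕ)
  inside  = filter inside? (tuples ns)
  outside = filter (¬? ∘ inside?) (tuples ns)

  inside+outside : length inside + length outside ≡ card𝒜 ns
  inside+outside = length-filter+length-filter¬ inside? (tuples ns)

  classify : ∀ {x y} → (x , y) ∈ cartesianProduct inside outside →
    InA ns x × InA ns y × In∪ H x × ¬ In∪ H y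
  classify xy∈ with ∈-cartesianProduct⁻ inside outside xy∈
  ... | x∈in , y∈out with ∈-filter⁻ inside? {xs = tuples ns} x∈in | ∈-filter⁻ (¬? ∘ inside?) {xs = tuples ns} y∈out
  ... | x∈𝒜 , x∈∪H | y∈𝒜 , y∉∪H = tuples-sound x∈𝒜 , tuples-sound y∈𝒜 , x∈∪H , y∉∪H

  encode : ∀ {xy} → xy ∈ cartesianProduct inside outside → List ℕ × List ℕ × List ℕ
  encode {x , y} xy∈ = let x∈𝒜 , y∈𝒜 , x∈∪H , _ = classify xy∈ in Encode.code x∈𝒜 y∈𝒜 x∈∪H

  inside*outside≤ : length inside * length outside ≤ length H * length G * card𝒜 ns
  inside*outside≤ = begin
    length inside * length outside             ≡⟨ length-cartesianProduct inside outside ⟨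
    length (cartesianProduct inside outside)   ≤⟨ length-≤-of-retraction codes inside×outside-unique
                                                    encode encode∈ decode decode-encode ⟩
    length codes                               ≡⟨ length-codes ⟩
    length H * (length G * card𝒜 ns)           ≡⟨ ℕ.*-assoc (length H) (length G) (card𝒜 ns) ⟨
    length H * length G * card𝒜 ns             ∎
    where
    open ℕ.≤-Reasoning
    codes : List (List ℕ × List ℕ × List ℕ)
    codes = cartesianProduct H (cartesianProduct G (tuples ns))

    length-codes : length codes ≡ length H * (length G * card𝒜 ns)
    length-codes = trans (length-cartesianProduct H _) (cong (length H *_) (length-cartesianProduct G (tuples ns)))

    inside×outside-unique : Unique (cartesianProduct inside outside)
    inside×outside-unique = Unique.cartesianProduct⁺ (Unique.filter⁺ inside? (tuples-unique ns))
                                                     (Unique.filter⁺ (¬? ∘ inside?) (tuples-unique ns))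

    encode∈ : ∀ {xy} (xy∈ : xy ∈ cartesianProduct inside outside) → encode xy∈ ∈ codes
    encode∈ {x , y} xy∈ = let x∈𝒜 , y∈𝒜 , x∈∪H , _ = classify xy∈ in Encode.code∈ x∈𝒜 y∈𝒜 x∈∪H

    decode-encode : ∀ {xy} (xy∈ : xy ∈ cartesianProduct inside outside) → decode (encode xy∈) ≡ xy
    decode-encode {x , y} xy∈ = let x∈𝒜 , y∈𝒜 , x∈∪H , y∉∪H = classify xy∈ in Encode.decode-code x∈𝒜 y∈𝒜 x∈∪H y∉∪H

completed-square-bound : ∀ U S P {N : ℤ} → N ≡ U +ℤ S → U *ℤ S ≤ℤ P *ℤ N →
  N *ℤ N ≤ℤ ((+ 2) *ℤ U - N) *ℤ ((+ 2) *ℤ U - N) +ℤ (+ 4) *ℤ P *ℤ N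
completed-square-bound U S P {N} refl US≤PN = begin
  N *ℤ N                          ≡⟨ square-identity U S ⟩
  D *ℤ D +ℤ (+ 4) *ℤ (U *ℤ S)     ≤⟨ ℤ.+-monoʳ-≤ (D *ℤ D) (ℤ.*-monoˡ-≤-nonNeg (+ 4) US≤PN) ⟩
  D *ℤ D +ℤ (+ 4) *ℤ (P *ℤ N)     ≡⟨ cong (D *ℤ D +ℤ_) (ℤ.*-assoc (+ 4) P N) ⟨
  D *ℤ D +ℤ (+ 4) *ℤ P *ℤ N       ∎
  where
  open ℤ.≤-Reasoning
  D : ℤ
  D = (+ 2) *ℤ U - N
  square-identity : ∀ a b → (a +ℤ b) *ℤ (a +ℤ b)
    ≡ ((+ 2) *ℤ a - (a +ℤ b)) *ℤ ((+ 2) *ℤ a - (a +ℤ b)) +ℤ (+ 4) *ℤ (a *ℤ b)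
  square-identity = solve-∀

square-alternative : ∀ U S P {N : ℤ} → N ≡ U +ℤ S → U *ℤ S ≤ℤ P *ℤ N →
    ((N ≤ℤ (+ 2) *ℤ U) × (N *ℤ N ≤ℤ ((+ 2) *ℤ U - N) *ℤ ((+ 2) *ℤ U - N) +ℤ (+ 4) *ℤ P *ℤ N))
  ⊎ (((+ 2) *ℤ U ≤ℤ N) × (N *ℤ N ≤ℤ (N - (+ 2) *ℤ U) *ℤ (N - (+ 2) *ℤ U) +ℤ (+ 4) *ℤ P *ℤ N))
square-alternative U S P {N} N≡U+S US≤PN with ℤ.≤-total N ((+ 2) *ℤ U)
... | inj₁ N≤2U = inj₁ (N≤2U , completed-square-bound U S P N≡U+S US≤PN)
... | inj₂ 2U≤N = inj₂ (2U≤N , subst (λ D² → N *ℤ N ≤ℤ D² +ℤ (+ 4) *ℤ P *ℤ N)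
                                     (square-flip ((+ 2) *ℤ U) N) (completed-square-bound U S P N≡U+S US≤PN))
  where
  square-flip : ∀ a b → (a - b) *ℤ (a - b) ≡ (b - a) *ℤ (b - a)
  square-flip = solve-∀

lemma7p8 : (ns : List ℕ)
    → All (λ n → 1 ≤ n) ns
    → reverse ns ≡ ns
    → (H G : List (List ℕ))
    → Unique H → Unique G
    → All (InĀ ns) H → All (InĀ ns) G
    → PrefixFree H → PrefixFree G
    → 4 * (length H * length G) ≤ card𝒜 ns
    → (∀ x → InA ns x → (In∪ H x ⇔ In∪rev G x))
    → let N = + card𝒜 ns
          u = + card∪ ns H
          p = + (length H * length G)
      in ((N ≤ℤ (+ 2) *ℤ u) × (N *ℤ N ≤ℤ ((+ 2) *ℤ u - N) *ℤ ((+ 2) *ℤ u - N) +ℤ (+ 4) *ℤ p *ℤ N))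
       ⊎ (((+ 2) *ℤ u ≤ℤ N) × (N *ℤ N ≤ℤ (N - (+ 2) *ℤ u) *ℤ (N - (+ 2) *ℤ u) +ℤ (+ 4) *ℤ p *ℤ N))
lemma7p8 ns _ _ H G _ _ _ _ _ _ _ ∪H⇔∪Grev =
  square-alternative (+ length inside) (+ length outside) (+ (length H * length G)) N≡u+s us≤pN
  where
  open PairCode ns H G ∪H⇔∪Grev
  N≡u+s : + card𝒜 ns ≡ + length inside +ℤ + length outside
  N≡u+s = trans (cong +_ (sym inside+outside)) (ℤ.pos-+ (length inside) (length outside))
  us≤pN : + length inside *ℤ + length outside ≤ℤ + (length H * length G) *ℤ + card𝒜 ns
  us≤pN = subst₂ _≤ℤ_ (ℤ.pos-* (length inside) (length outside)) (ℤ.pos-* (length H * length G) (card𝒜 ns))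
            (+≤+ inside*outside≤)
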